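{- For every positive integer $n$ there exists an extremal square-free word of length at least $n$ over a $3$-letter alphabet.
   Context: A square is a non-empty word of the form $XX$; a word is square-free if it contains no square as a factor (contiguous subword). Let $\mathbb A$ be a finite alphabet and $W$ a finite word over $\mathbb A$. An extension of $W$ is any word of the form $W'xW''$ where $x\in\mathbb A$ and $W=W'W''$ (the words $W'$, $W''$ may be empty, so a letter may be inserted at any position, including the beginning and the end). A square-free word $W$ over $\mathbb A$ is extremal over $\mathbb A$ if no extension of $W$ is square-free. -}

module Defs where

open import Data.List using (List; []; _∷_; _++_; length)
open import Data.Product using (Σ; ∃; _×_; _,_)
open import Relation.Binary.PropositionalEquality using (_≡_)
open import Relation.Nullary using (¬_)

Factor : {A : Set} → List A → List A → Set
Factor {A} F W = Σ (List A) λ U → Σ (List A) λ V → W ≡ U ++ F ++ V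

IsSquare : {A : Set} → List A → Set
IsSquare {A} S = Σ (List A) λ X → ¬ (X ≡ []) × S ≡ X ++ X

SquareFree : {A : Set} → List A → Set
SquareFree {A} W = (F : List A) → Factor F W → ¬ IsSquare F

Extension : {A : Set} → List A → List A → Set
Extension {A} E W =
  Σ (List A) λ W₁ → Σ A λ x → Σ (List A) λ W₂ →
    (W ≡ W₁ ++ W₂) × (E ≡ W₁ ++ x ∷ W₂)

Extremal : {A : Set} → List A → Set
Extremal {A} W = SquareFree W × ((E : List A) → Extension E W → ¬ SquareFree E)

module Submission where

-- Let h be the 50-uniform morphism below on {0,1,2} extended by two frame letters ⊢ and ⊣.
-- For a square-free ternary w starting with 012 and ending with 210, the word h(⊢ w ⊣) is extremal.
-- It is square-free because the factor of length 16 at offset 10 of every block occurs in h(y)h(z)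
-- only at that offset: a square of period at least 50 + 26 therefore has a period that is a multiple
-- of 50 and pulls back to a square of ⊢ w ⊣, while a shorter square lies in the image of four
-- consecutive letters, which a computation rules out.  Inserting a letter anywhere creates a square
-- inside the images of the (at most three) letters around the insertion point, again by computation.
-- The words hⁿ(0) satisfy the hypotheses on w, and their lengths grow without bound.

open import Data.Bool using (Bool; true; false; not; _∧_; _∨_)
open import Data.Empty using (⊥; ⊥-elim)
open import Data.Fin using (Fin; zero; suc)
open import Data.Fin.Properties using (all?) renaming (_≟_ to _≟ᶠ_)
open import Data.List using (List; []; _∷_; _++_; _∷ʳ_; length; take; drop; map; reverse; concatMap)
open import Data.List.Membership.Propositional using (_∉_)
open import Data.List.Membership.Propositional.Properties using (∈-++⁺ˡ; ∈-++⁺ʳ; ∈-++⁻; ∈-map⁻)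
open import Data.List.Properties
  using (∷-injective; length-++; length-map; length-take; length-drop; ++-assoc; ++-identityʳ; map-++; map-injective;
         take-map; drop-map; take-take; take-drop; drop-drop; take++drop≡id; take-[]; drop-[]; take-all;
         concatMap-++; reverse-++; reverse-involutive; unfold-reverse; ≡-dec)
open import Data.List.Relation.Unary.Any using (here)
open import Data.List.Relation.Unary.Any.Properties using (reverse⁻)
open import Data.Nat using (ℕ; zero; suc; _+_; _*_; _∸_; _⊓_; _≤_; _<_; _>_; s≤s; z≤n; NonZero; >-nonZero⁻¹)
open import Data.Nat.DivMod using (_/_; _%_; m%n<n; m≡m%n+[m/n]*n)
open import Data.Nat.Properties
open import Data.Nat.Tactic.RingSolver using (solve-∀)
open import Data.Product using (Σ; ∃; ∃₂; _×_; _,_; proj₁; proj₂; uncurry)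
open import Data.Sum using (_⊎_; inj₁; inj₂; [_,_]′)
open import Function using (_∘_)
open import Function.Definitions using (Injective)
open import Relation.Binary.Definitions using (DecidableEquality)
open import Relation.Binary.PropositionalEquality
open import Relation.Nullary using (¬_; Dec; yes; no; _because_; does; proof; map′; ¬?; _×-dec_; _⊎-dec_; _→-dec_)
open import Relation.Nullary.Decidable using (from-yes)
open import Relation.Nullary.Reflects using (Reflects; ofʸ; ofⁿ; ¬-reflects; _×-reflects_; _⊎-reflects_)
open import Relation.Unary using (Decidable)
open import Defs

-- Slices and insertions

module _ {A : Set} where

  slice : ℕ → ℕ → List A → List A
  slice i n V = take n (drop i V)

  insert : ℕ → A → List A → List A
  insert j x V = take j V ++ x ∷ drop j V

  take-++-length : ∀ {n} (X Y : List A) → length X ≡ n → take n (X ++ Y) ≡ X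
  take-++-length []      Y refl = refl
  take-++-length (x ∷ X) Y refl = cong (x ∷_) (take-++-length X Y refl)

  drop-++-length : ∀ {n} (X Y : List A) → length X ≡ n → drop n (X ++ Y) ≡ Y
  drop-++-length []      Y refl = refl
  drop-++-length (x ∷ X) Y refl = drop-++-length X Y refl

  take-++-+ : ∀ {n} k (X Y : List A) → length X ≡ n → take (n + k) (X ++ Y) ≡ X ++ take k Y
  take-++-+ k []      Y refl = refl
  take-++-+ k (x ∷ X) Y refl = cong (x ∷_) (take-++-+ k X Y refl)

  take-++-≤ : ∀ n (X Y : List A) → n ≤ length X → take n (X ++ Y) ≡ take n X
  take-++-≤ zero    X       Y _         = refl
  take-++-≤ (suc n) (x ∷ X) Y (s≤s n≤X) = cong (x ∷_) (take-++-≤ n X Y n≤X)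

  drop-++-≤ : ∀ n (X Y : List A) → n ≤ length X → drop n (X ++ Y) ≡ drop n X ++ Y
  drop-++-≤ zero    X       Y _         = refl
  drop-++-≤ (suc n) (x ∷ X) Y (s≤s n≤X) = drop-++-≤ n X Y n≤X

  length-take-≤ : ∀ n (X : List A) → n ≤ length X → length (take n X) ≡ n
  length-take-≤ n X n≤X = trans (length-take n X) (m≤n⇒m⊓n≡m n≤X)

  ≤-length-drop : ∀ i n (X : List A) → i + n ≤ length X → n ≤ length (drop i X)
  ≤-length-drop i n X i+n≤X =
    subst (n ≤_) (sym (length-drop i X)) (m+n≤o⇒m≤o∸n n (subst (_≤ length X) (+-comm i n) i+n≤X))

  length-slice : ∀ i n (X : List A) → i + n ≤ length X → length (slice i n X) ≡ n
  length-slice i n X i+n≤X = length-take-≤ n (drop i X) (≤-length-drop i n X i+n≤X)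

  slice-++-≤ : ∀ i n (X Y : List A) → i + n ≤ length X → slice i n (X ++ Y) ≡ slice i n X
  slice-++-≤ i n X Y i+n≤X = begin
    take n (drop i (X ++ Y))   ≡⟨ cong (take n) (drop-++-≤ i X Y (m+n≤o⇒m≤o i i+n≤X)) ⟩
    take n (drop i X ++ Y)     ≡⟨ take-++-≤ n (drop i X) Y (≤-length-drop i n X i+n≤X) ⟩
    take n (drop i X)          ∎
    where open ≡-Reasoning

  ++-cancel-length : ∀ (X X′ Y Y′ : List A) → length X ≡ length X′ → X ++ Y ≡ X′ ++ Y′ → X ≡ X′ × Y ≡ Y′
  ++-cancel-length X X′ Y Y′ X≡X′ eq =
      trans (sym (take-++-length X Y X≡X′)) (trans (cong (take (length X′)) eq) (take-++-length X′ Y′ refl))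
    , trans (sym (drop-++-length X Y X≡X′)) (trans (cong (drop (length X′)) eq) (drop-++-length X′ Y′ refl))

  slice-slice : ∀ w a n {K} (V : List A) → a + n ≤ K → slice a n (slice w K V) ≡ slice (w + a) n V
  slice-slice w a n {K} V a+n≤K = begin
    take n (drop a (take K (drop w V)))             ≡⟨ cong (λ k → take n (drop a (take k (drop w V)))) K≡ ⟨
    take n (drop a (take (a + (n + e)) (drop w V))) ≡⟨ cong (take n) (take-drop (n + e) a (drop w V)) ⟨
    take n (take (n + e) (drop a (drop w V)))       ≡⟨ take-take n (n + e) _ ⟩
    take (n ⊓ (n + e)) (drop a (drop w V))          ≡⟨ cong₂ take (m≤n⇒m⊓n≡m (m≤m+n n e)) (drop-drop w a V) ⟩
    take n (drop (w + a) V)                         ∎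
    where
    open ≡-Reasoning
    e = K ∸ (a + n)
    K≡ : a + (n + e) ≡ K
    K≡ = trans (sym (+-assoc a n e)) (m+[n∸m]≡n a+n≤K)

  slice-≡-inner : ∀ {i j p} a n (V : List A) → a + n ≤ p →
                  slice i p V ≡ slice j p V → slice (i + a) n V ≡ slice (j + a) n V
  slice-≡-inner {i} {j} {p} a n V a+n≤p eq = begin
    slice (i + a) n V          ≡⟨ slice-slice i a n V a+n≤p ⟨
    slice a n (slice i p V)    ≡⟨ cong (slice a n) eq ⟩
    slice a n (slice j p V)    ≡⟨ slice-slice j a n V a+n≤p ⟩
    slice (j + a) n V          ∎
    where open ≡-Reasoning

  slice-decomposition : ∀ i n (V : List A) → V ≡ take i V ++ slice i n V ++ drop (i + n) V
  slice-decomposition i n V = begin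
    V                                                ≡⟨ take++drop≡id i V ⟨
    take i V ++ drop i V                             ≡⟨ cong (take i V ++_) (take++drop≡id n (drop i V)) ⟨
    take i V ++ slice i n V ++ drop n (drop i V)     ≡⟨ cong (λ z → take i V ++ slice i n V ++ z) (drop-drop i n V) ⟩
    take i V ++ slice i n V ++ drop (i + n) V        ∎
    where open ≡-Reasoning

  slice-factor : ∀ i n (V : List A) → Factor (slice i n V) V
  slice-factor i n V = take i V , drop (i + n) V , slice-decomposition i n V

  drop-∷ : ∀ k (v : List A) → k < length v → ∃₂ λ y rest → drop k v ≡ y ∷ rest
  drop-∷ zero    (y ∷ v) _         = y , v , refl
  drop-∷ (suc k) (_ ∷ v) (s≤s k<v) = drop-∷ k v k<v

  drop-suc : ∀ k (v : List A) {y rest} → drop k v ≡ y ∷ rest → drop (suc k) v ≡ rest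
  drop-suc zero    (_ ∷ v) refl = refl
  drop-suc (suc k) (_ ∷ v) eq   = drop-suc k v eq

  take-suc : ∀ q (X : List A) {z rest} → drop q X ≡ z ∷ rest → take (suc q) X ≡ take q X ∷ʳ z
  take-suc zero    (x ∷ X) refl = refl
  take-suc (suc q) (x ∷ X) eq   = cong (x ∷_) (take-suc q X eq)

  slice-∷ : ∀ a q (v : List A) {y rest} → drop a v ≡ y ∷ rest → slice a (suc q) v ≡ y ∷ slice (suc a) q v
  slice-∷ a q v eq = trans (cong (take (suc q)) eq) (cong (λ r → _ ∷ take q r) (sym (drop-suc a v eq)))

  slice-∷ʳ : ∀ a q (v : List A) {z rest} → drop (a + q) v ≡ z ∷ rest → slice a (suc q) v ≡ slice a q v ∷ʳ z
  slice-∷ʳ a q v eq = take-suc q (drop a v) (trans (drop-drop a q v) eq)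

  insert-inside : ∀ (P W S : List A) d x → d ≤ length W →
                  insert (length P + d) x (P ++ W ++ S) ≡ P ++ insert d x W ++ S
  insert-inside []      W S d x d≤W = begin
    take d (W ++ S) ++ x ∷ drop d (W ++ S)   ≡⟨ cong₂ (λ u v → u ++ x ∷ v) (take-++-≤ d W S d≤W) (drop-++-≤ d W S d≤W) ⟩
    take d W ++ x ∷ (drop d W ++ S)          ≡⟨ ++-assoc (take d W) (x ∷ drop d W) S ⟨
    (take d W ++ x ∷ drop d W) ++ S          ∎
    where open ≡-Reasoning
  insert-inside (p ∷ P) W S d x d≤W = cong (p ∷_) (insert-inside P W S d x d≤W)

  extension⇒insert : ∀ {E W : List A} → Extension E W → ∃₂ λ j x → j ≤ length W × E ≡ insert j x W
  extension⇒insert (W₁ , x , W₂ , refl , refl) =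
    length W₁ , x , subst (length W₁ ≤_) (sym (length-++ W₁)) (m≤m+n _ _) ,
    sym (cong₂ (λ u v → u ++ x ∷ v) (take-++-length W₁ W₂ refl) (drop-++-length W₁ W₂ refl))

slice-map : ∀ {A B : Set} (f : A → B) i n (V : List A) → slice i n (map f V) ≡ map f (slice i n V)
slice-map f i n V = trans (cong (take n) (drop-map i V)) (take-map n (drop i V))

-- Squares

module _ {A : Set} where

  SquareAt : List A → ℕ → ℕ → Set
  SquareAt V i p = p > 0 × i + (p + p) ≤ length V × slice i p V ≡ slice (i + p) p V

  square⇒squareAt : ∀ {F V : List A} → Factor F V → IsSquare F → ∃₂ λ i p → SquareAt V i p
  square⇒squareAt {V = V} (U , W , refl) (X , X≢[] , refl) = length U , length X , p>0 X X≢[] , bound , halves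
    where
    p>0 : ∀ (Y : List A) → ¬ Y ≡ [] → length Y > 0
    p>0 []      Y≢[] = ⊥-elim (Y≢[] refl)
    p>0 (_ ∷ _) _    = s≤s z≤n
    bound : length U + (length X + length X) ≤ length V
    bound rewrite length-++ U {(X ++ X) ++ W} | length-++ (X ++ X) {W} | length-++ X {X} =
      +-monoʳ-≤ (length U) (m≤m+n _ (length W))
    rest : drop (length U) V ≡ X ++ X ++ W
    rest = trans (drop-++-length U _ refl) (++-assoc X X W)
    halves : slice (length U) (length X) V ≡ slice (length U + length X) (length X) V
    halves = begin
      take (length X) (drop (length U) V)                    ≡⟨ cong (take (length X)) rest ⟩
      take (length X) (X ++ X ++ W)                          ≡⟨ take-++-length X _ refl ⟩
      X                                                      ≡⟨ take-++-length X W refl ⟨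
      take (length X) (X ++ W)                               ≡⟨ cong (take (length X)) (drop-++-length X (X ++ W) refl) ⟨
      take (length X) (drop (length X) (X ++ X ++ W))        ≡⟨ cong (take (length X) ∘ drop (length X)) rest ⟨
      take (length X) (drop (length X) (drop (length U) V))  ≡⟨ cong (take (length X)) (drop-drop (length U) (length X) V) ⟩
      take (length X) (drop (length U + length X) V)         ∎
      where open ≡-Reasoning

  squareAt⇒square : ∀ {V : List A} {i p} → SquareAt V i p → Σ (List A) λ F → Factor F V × IsSquare F
  squareAt⇒square {V} {i} {p} (p>0 , bound , halves) =
    slice i (p + p) V , slice-factor i (p + p) V , slice i p V , X≢[] , doubled
    where
    X≢[] : ¬ slice i p V ≡ []
    X≢[] X≡[] = <⇒≢ p>0 (trans (sym (cong length X≡[])) (length-slice i p V (≤-trans (+-monoʳ-≤ i (m≤m+n p p)) bound)))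
    doubled : slice i (p + p) V ≡ slice i p V ++ slice i p V
    doubled = begin
      take (p + p) (drop i V)                                ≡⟨ take++drop≡id p _ ⟨
      take p (take (p + p) (drop i V)) ++ drop p (take (p + p) (drop i V))
        ≡⟨ cong₂ _++_ (trans (take-take p (p + p) _) (cong (λ k → take k (drop i V)) (m≤n⇒m⊓n≡m (m≤m+n p p))))
                      (sym (take-drop p p (drop i V))) ⟩
      slice i p V ++ take p (drop p (drop i V))              ≡⟨ cong (λ z → slice i p V ++ take p z) (drop-drop i p V) ⟩
      slice i p V ++ slice (i + p) p V                       ≡⟨ cong (slice i p V ++_) halves ⟨
      slice i p V ++ slice i p V                             ∎
      where open ≡-Reasoning

  squareFree⇒¬squareAt : ∀ {V : List A} → SquareFree V → ∀ i p → ¬ SquareAt V i p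
  squareFree⇒¬squareAt sf i p sq = let F , F⊑V , isSq = squareAt⇒square {i = i} {p} sq in sf F F⊑V isSq

  ¬squareAt⇒squareFree : ∀ {V : List A} → (∀ i p → ¬ SquareAt V i p) → SquareFree V
  ¬squareAt⇒squareFree noSq F F⊑V isSq = let i , p , sq = square⇒squareAt F⊑V isSq in noSq i p sq

  factor-trans : ∀ {F G V : List A} → Factor F G → Factor G V → Factor F V
  factor-trans {F} (U , W , refl) (U′ , W′ , refl) = U′ ++ U , W ++ W′ , (begin
    U′ ++ (U ++ F ++ W) ++ W′     ≡⟨ cong (U′ ++_) (++-assoc U (F ++ W) W′) ⟩
    U′ ++ U ++ (F ++ W) ++ W′     ≡⟨ cong (λ z → U′ ++ U ++ z) (++-assoc F W W′) ⟩
    U′ ++ U ++ F ++ W ++ W′       ≡⟨ ++-assoc U′ U _ ⟨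
    (U′ ++ U) ++ F ++ W ++ W′     ∎)
    where open ≡-Reasoning

  squareFree-factor : ∀ {G V : List A} → Factor G V → SquareFree V → SquareFree G
  squareFree-factor G⊑V sf F F⊑G = sf F (factor-trans F⊑G G⊑V)

  ¬squareFree-slice : ∀ i K (V : List A) → ¬ SquareFree (slice i K V) → ¬ SquareFree V
  ¬squareFree-slice i K V ¬sf sf = ¬sf (squareFree-factor (slice-factor i K V) sf)

  ¬squareFree-inside : ∀ (P W S : List A) d x → d ≤ length W → ¬ SquareFree (insert d x W) →
                       ¬ SquareFree (insert (length P + d) x (P ++ W ++ S))
  ¬squareFree-inside P W S d x d≤W ¬sf sf = ¬sf (squareFree-factor (P , S , insert-inside P W S d x d≤W) sf)

  squareFree-[] : SquareFree {A} []
  squareFree-[] = ¬squareAt⇒squareFree λ i p (p>0 , bound , _) →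
    <⇒≱ (<-≤-trans p>0 (m≤m+n p p)) (m+n≤o⇒n≤o i bound)

  squareFree-∷⁻ : ∀ {x : A} {V} → SquareFree (x ∷ V) → SquareFree V
  squareFree-∷⁻ {x} = squareFree-factor (x ∷ [] , [] , sym (cong (x ∷_) (++-identityʳ _)))

  -- A square through the first letter repeats that letter later on.
  squareFree-∷ : ∀ {x : A} {V} → x ∉ V → SquareFree V → SquareFree (x ∷ V)
  squareFree-∷ x∉V sf F ([] , W , eq) (X , X≢[] , refl) with X | eq
  ... | []     | _    = X≢[] refl
  ... | y ∷ X′ | refl = x∉V (∈-++⁺ˡ (∈-++⁺ʳ X′ (here refl)))
  squareFree-∷ x∉V sf F (u ∷ U , W , eq) isSq = sf F (U , W , proj₂ (∷-injective eq)) isSq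

  squareFree-reverse : ∀ {V : List A} → SquareFree V → SquareFree (reverse V)
  squareFree-reverse {V} sf F (U , W , rV≡) (X , X≢[] , refl) =
    sf (reverse X ++ reverse X) (reverse W , reverse U , V≡) (reverse X , rX≢[] , refl)
    where
    open ≡-Reasoning
    rX≢[] : ¬ reverse X ≡ []
    rX≢[] rX≡[] = X≢[] (trans (sym (reverse-involutive X)) (cong reverse rX≡[]))
    V≡ : V ≡ reverse W ++ (reverse X ++ reverse X) ++ reverse U
    V≡ = begin
      V                                                   ≡⟨ reverse-involutive V ⟨
      reverse (reverse V)                                 ≡⟨ cong reverse rV≡ ⟩
      reverse (U ++ (X ++ X) ++ W)                        ≡⟨ reverse-++ U _ ⟩
      reverse ((X ++ X) ++ W) ++ reverse U                ≡⟨ cong (_++ reverse U) (reverse-++ (X ++ X) W) ⟩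
      (reverse W ++ reverse (X ++ X)) ++ reverse U        ≡⟨ ++-assoc (reverse W) _ _ ⟩
      reverse W ++ reverse (X ++ X) ++ reverse U          ≡⟨ cong (λ z → reverse W ++ z ++ reverse U) (reverse-++ X X) ⟩
      reverse W ++ (reverse X ++ reverse X) ++ reverse U  ∎

  squareFree-∷ʳ : ∀ {x : A} {V} → x ∉ V → SquareFree V → SquareFree (V ∷ʳ x)
  squareFree-∷ʳ {x} {V} x∉V sf = subst SquareFree reversed
    (squareFree-reverse (squareFree-∷ (x∉V ∘ reverse⁻) (squareFree-reverse sf)))
    where
    reversed : reverse (x ∷ reverse V) ≡ V ∷ʳ x
    reversed = trans (unfold-reverse x (reverse V)) (cong (_∷ʳ x) (reverse-involutive V))

  squareAt-slice : ∀ {V : List A} {i p} w K → SquareAt V i p → w ≤ i → i + (p + p) ≤ w + K → w + K ≤ length V →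
                   SquareAt (slice w K V) (i ∸ w) p
  squareAt-slice {V} {i} {p} w K (p>0 , _ , halves) w≤i end≤ w+K≤V = p>0 , bound , halves′
    where
    d = i ∸ w
    i≡ : w + d ≡ i
    i≡ = m+[n∸m]≡n w≤i
    d+2p≤K : d + (p + p) ≤ K
    d+2p≤K = +-cancelˡ-≤ w _ _ (subst (_≤ w + K) (trans (cong (_+ (p + p)) (sym i≡)) (+-assoc w d _)) end≤)
    bound : d + (p + p) ≤ length (slice w K V)
    bound = subst (d + (p + p) ≤_) (sym (length-slice w K V w+K≤V)) d+2p≤K
    halves′ : slice d p (slice w K V) ≡ slice (d + p) p (slice w K V)
    halves′ = begin
      slice d p (slice w K V)        ≡⟨ slice-slice w d p V (≤-trans (+-monoʳ-≤ d (m≤m+n p p)) d+2p≤K) ⟩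
      slice (w + d) p V              ≡⟨ cong (λ k → slice k p V) i≡ ⟩
      slice i p V                    ≡⟨ halves ⟩
      slice (i + p) p V              ≡⟨ cong (λ k → slice (k + p) p V) i≡ ⟨
      slice (w + d + p) p V          ≡⟨ cong (λ k → slice k p V) (+-assoc w d p) ⟩
      slice (w + (d + p)) p V        ≡⟨ slice-slice w (d + p) p V (subst (_≤ K) (sym (+-assoc d p p)) d+2p≤K) ⟨
      slice (d + p) p (slice w K V)  ∎
      where open ≡-Reasoning

  squareAt-copy : ∀ {V : List A} {i p} o n → SquareAt V i p → i ≤ o → o + n ≤ i + p →
                  slice o n V ≡ slice (o + p) n V
  squareAt-copy {V} {i} {p} o n (_ , _ , halves) i≤o o+n≤ = begin
    slice o n V            ≡⟨ cong (λ k → slice k n V) o≡ ⟨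
    slice (i + a) n V      ≡⟨ slice-≡-inner {i = i} {j = i + p} a n V a+n≤p halves ⟩
    slice (i + p + a) n V  ≡⟨ cong (λ k → slice k n V) (trans (+-assoc i p a) (trans (cong (i +_) (+-comm p a))
                                                          (trans (sym (+-assoc i a p)) (cong (_+ p) o≡)))) ⟩
    slice (o + p) n V      ∎
    where
    open ≡-Reasoning
    a = o ∸ i
    o≡ : i + a ≡ o
    o≡ = m+[n∸m]≡n i≤o
    a+n≤p : a + n ≤ p
    a+n≤p = +-cancelˡ-≤ i _ _ (subst (_≤ i + p) (trans (cong (_+ n) (sym o≡)) (+-assoc i a n)) o+n≤)

  squareAt-prefix : ∀ {n} (V : List A) {y Y} → n > 0 → drop n V ≡ y ∷ Y → take n V ≡ take n (y ∷ Y) → SquareAt V 0 n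
  squareAt-prefix {n} V {y} {Y} n>0 Y≡ halves = n>0 , bound , trans halves (cong (take n) (sym Y≡))
    where
    remaining : length V ∸ n ≡ suc (length Y)
    remaining = trans (sym (length-drop n V)) (cong length Y≡)
    n≤V : n ≤ length V
    n≤V = <⇒≤ (m∸n≢0⇒n<m (λ eq → 0≢1+n (trans (sym eq) remaining)))
    n≤rest : n ≤ length V ∸ n
    n≤rest = begin
      n                         ≡⟨ trans (sym (length-take-≤ n V n≤V)) (cong length halves) ⟩
      length (take n (y ∷ Y))   ≡⟨ length-take n (y ∷ Y) ⟩
      n ⊓ suc (length Y)        ≤⟨ m⊓n≤n n _ ⟩
      suc (length Y)            ≡⟨ remaining ⟨
      length V ∸ n              ∎
      where open ≤-Reasoning
    bound : 0 + (n + n) ≤ length V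
    bound = ≤-trans (+-monoʳ-≤ n n≤rest) (≤-reflexive (m+[n∸m]≡n n≤V))

  noSquareAt-prefix : ∀ {p} (V : List A) → drop (suc p) V ≡ [] → ∀ {q} → p ≤ q → ¬ SquareAt V 0 (suc q)
  noSquareAt-prefix {p} V empty {q} p≤q (_ , bound , _) = <⇒≱ (m<m+n (suc q) (s≤s z≤n)) (begin
    suc q + suc q  ≤⟨ bound ⟩
    length V       ≤⟨ m∸n≡0⇒m≤n (trans (sym (length-drop (suc p) V)) (cong length empty)) ⟩
    suc p          ≤⟨ s≤s p≤q ⟩
    suc q          ∎)
    where open ≤-Reasoning

squareFree-map : ∀ {A B : Set} {f : A → B} → Injective _≡_ _≡_ f → ∀ {V} → SquareFree V → SquareFree (map f V)
squareFree-map {f = f} f-inj {V} sf = ¬squareAt⇒squareFree λ i p (p>0 , bound , halves) →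
  squareFree⇒¬squareAt sf i p (p>0 , subst (i + (p + p) ≤_) (length-map f V) bound ,
    map-injective f-inj (trans (sym (slice-map f i p V)) (trans halves (slice-map f (i + p) p V))))

-- Deciding square-freeness

reflects-map : ∀ {P Q : Set} {b} → (P → Q) → (Q → P) → Reflects P b → Reflects Q b
reflects-map f g (ofʸ p)  = ofʸ (f p)
reflects-map f g (ofⁿ ¬p) = ofⁿ (¬p ∘ g)

-- The search is written with booleans, and only reflected afterwards, so that the finite checks
-- below evaluate quickly.
module _ {A : Set} (_≟_ : DecidableEquality A) where

  take-≡ᵇ : ℕ → List A → List A → Bool
  take-≡ᵇ zero    _       _       = true
  take-≡ᵇ (suc n) []      []      = true
  take-≡ᵇ (suc n) (x ∷ V) (y ∷ Y) = does (x ≟ y) ∧ take-≡ᵇ n V Y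
  take-≡ᵇ (suc n) _       _       = false

  take-≡-reflects : ∀ n V Y → Reflects (take n V ≡ take n Y) (take-≡ᵇ n V Y)
  take-≡-reflects zero    _       _       = ofʸ refl
  take-≡-reflects (suc n) []      []      = ofʸ refl
  take-≡-reflects (suc n) []      (_ ∷ _) = ofⁿ λ ()
  take-≡-reflects (suc n) (_ ∷ _) []      = ofⁿ λ ()
  take-≡-reflects (suc n) (x ∷ V) (y ∷ Y) =
    reflects-map (uncurry (cong₂ _∷_)) ∷-injective (proof (x ≟ y) ×-reflects take-≡-reflects n V Y)

  -- Y is kept equal to drop (suc p) V, so that trying the next half-length costs a single step.
  squarePrefixᵇ : ℕ → List A → List A → Bool
  squarePrefixᵇ p V []      = false
  squarePrefixᵇ p V (y ∷ Y) = take-≡ᵇ (suc p) V (y ∷ Y) ∨ squarePrefixᵇ (suc p) V Y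

  squarePrefix-reflects : ∀ V p Y → drop (suc p) V ≡ Y →
                          Reflects (∃ λ q → p ≤ q × SquareAt V 0 (suc q)) (squarePrefixᵇ p V Y)
  squarePrefix-reflects V p []      Y≡ = ofⁿ λ (q , p≤q , sq) → noSquareAt-prefix V Y≡ p≤q sq
  squarePrefix-reflects V p (y ∷ Y) Y≡ =
    reflects-map [ (λ sq → p , ≤-refl , sq) , (λ (q , p<q , sq) → q , <⇒≤ p<q , sq) ]′ split
      (reflects-map (squareAt-prefix V (s≤s z≤n) Y≡) (λ (_ , _ , halves) → trans halves (cong (take (suc p)) Y≡))
                    (take-≡-reflects (suc p) V (y ∷ Y))
       ⊎-reflects squarePrefix-reflects V (suc p) Y (drop-suc (suc p) V Y≡))
    where
    split : ∃ (λ q → p ≤ q × SquareAt V 0 (suc q)) →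
            SquareAt V 0 (suc p) ⊎ ∃ λ q → suc p ≤ q × SquareAt V 0 (suc q)
    split (q , p≤q , sq) with m≤n⇒m<n∨m≡n p≤q
    ... | inj₁ p<q  = inj₂ (q , p<q , sq)
    ... | inj₂ refl = inj₁ sq

  squareFreeᵇ : List A → Bool
  squareFreeᵇ []      = true
  squareFreeᵇ (x ∷ V) = not (squarePrefixᵇ 0 (x ∷ V) V) ∧ squareFreeᵇ V

  squareFree-reflects : ∀ V → Reflects (SquareFree V) (squareFreeᵇ V)
  squareFree-reflects []      = ofʸ squareFree-[]
  squareFree-reflects (x ∷ V) =
    reflects-map (λ (noPrefix , sf) → ¬squareAt⇒squareFree (noSquare noPrefix sf))
                 (λ sf → (λ (q , _ , sq) → squareFree⇒¬squareAt sf 0 (suc q) sq) , squareFree-∷⁻ sf)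
                 (¬-reflects (squarePrefix-reflects (x ∷ V) 0 V refl) ×-reflects squareFree-reflects V)
    where
    noSquare : ¬ (∃ λ q → 0 ≤ q × SquareAt (x ∷ V) 0 (suc q)) → SquareFree V → ∀ i p → ¬ SquareAt (x ∷ V) i p
    noSquare noPrefix sf zero    (suc q) sq                         = noPrefix (q , z≤n , sq)
    noSquare noPrefix sf (suc i) p       (p>0 , s≤s bound , halves) = squareFree⇒¬squareAt sf i p (p>0 , bound , halves)

  squareFree? : ∀ V → Dec (SquareFree V)
  squareFree? V = squareFreeᵇ V because squareFree-reflects V

-- Uniform morphisms

module Uniform {A B : Set} (h : B → List A) (L : ℕ) .{{_ : NonZero L}} (uniform : ∀ y → length (h y) ≡ L) where

  ĥ : List B → List A
  ĥ = concatMap h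

  length-ĥ : ∀ v → length (ĥ v) ≡ length v * L
  length-ĥ []      = refl
  length-ĥ (y ∷ v) = trans (length-++ (h y)) (cong₂ _+_ (uniform y) (length-ĥ v))

  drop-ĥ : ∀ k v → drop (k * L) (ĥ v) ≡ ĥ (drop k v)
  drop-ĥ zero    v       = refl
  drop-ĥ (suc k) []      = drop-[] (suc k * L)
  drop-ĥ (suc k) (y ∷ v) = begin
    drop (L + k * L) (h y ++ ĥ v)       ≡⟨ drop-drop L (k * L) _ ⟨
    drop (k * L) (drop L (h y ++ ĥ v))  ≡⟨ cong (drop (k * L)) (drop-++-length (h y) (ĥ v) (uniform y)) ⟩
    drop (k * L) (ĥ v)                  ≡⟨ drop-ĥ k v ⟩
    ĥ (drop k v)                        ∎
    where open ≡-Reasoning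

  take-ĥ : ∀ k v → take (k * L) (ĥ v) ≡ ĥ (take k v)
  take-ĥ zero    v       = refl
  take-ĥ (suc k) []      = take-[] (suc k * L)
  take-ĥ (suc k) (y ∷ v) = trans (take-++-+ (k * L) (h y) (ĥ v) (uniform y)) (cong (h y ++_) (take-ĥ k v))

  slice-ĥ : ∀ a q v → slice (a * L) (q * L) (ĥ v) ≡ ĥ (slice a q v)
  slice-ĥ a q v = trans (cong (take (q * L)) (drop-ĥ a v)) (take-ĥ q (drop a v))

  ĥ-∷≢[] : ∀ y u → ĥ (y ∷ u) ≢ []
  ĥ-∷≢[] y u eq = <⇒≢ (<-≤-trans (>-nonZero⁻¹ L) (m≤m+n L _)) (trans (sym (cong length eq)) (length-ĥ (y ∷ u)))

  ĥ-injective : Injective _≡_ _≡_ h → Injective _≡_ _≡_ ĥ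
  ĥ-injective h-inj {[]}    {[]}      _  = refl
  ĥ-injective h-inj {[]}    {y ∷ u}   eq = ⊥-elim (ĥ-∷≢[] y u (sym eq))
  ĥ-injective h-inj {y ∷ u} {[]}      eq = ⊥-elim (ĥ-∷≢[] y u eq)
  ĥ-injective h-inj {y ∷ u} {y′ ∷ u′} eq =
    let hy≡ , ĥu≡ = ++-cancel-length (h y) (h y′) (ĥ u) (ĥ u′) (trans (uniform y) (sym (uniform y′))) eq
    in cong₂ _∷_ (h-inj hy≡) (ĥ-injective h-inj ĥu≡)

  drop-ĥ-block : ∀ k v {y rest} → drop k v ≡ y ∷ rest → drop (k * L) (ĥ v) ≡ h y ++ ĥ rest
  drop-ĥ-block k v block = trans (drop-ĥ k v) (cong ĥ block)

  slice-ĥ-from : ∀ k v {y rest} → drop k v ≡ y ∷ rest → ∀ r n →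
                 slice (k * L + r) n (ĥ v) ≡ slice r n (h y ++ ĥ rest)
  slice-ĥ-from k v block r n =
    trans (cong (take n) (sym (drop-drop (k * L) r (ĥ v)))) (cong (take n ∘ drop r) (drop-ĥ-block k v block))

  slice-ĥ-block : ∀ k v {y rest} → drop k v ≡ y ∷ rest → ∀ r n → r + n ≤ L →
                  slice (k * L + r) n (ĥ v) ≡ slice r n (h y)
  slice-ĥ-block k v {y} {rest} block r n r+n≤L =
    trans (slice-ĥ-from k v block r n) (slice-++-≤ r n (h y) (ĥ rest) (subst (r + n ≤_) (sym (uniform y)) r+n≤L))

  slice-ĥ-prefix : ∀ k v {y rest} → drop k v ≡ y ∷ rest → ∀ n → n ≤ L → slice (k * L) n (ĥ v) ≡ take n (h y)
  slice-ĥ-prefix k v block n n≤L =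
    trans (cong (λ j → slice j n (ĥ v)) (sym (+-identityʳ (k * L)))) (slice-ĥ-block k v block 0 n n≤L)

  slice-ĥ-suffix : ∀ k v {y rest} → drop k v ≡ y ∷ rest → ∀ r → r ≤ L → slice (k * L + r) (L ∸ r) (ĥ v) ≡ drop r (h y)
  slice-ĥ-suffix k v {y} block r r≤L = trans (slice-ĥ-block k v block r (L ∸ r) (≤-reflexive (m+[n∸m]≡n r≤L)))
    (take-all (L ∸ r) (drop r (h y)) (≤-reflexive (trans (length-drop r (h y)) (cong (_∸ r) (uniform y)))))

  block-index : ∀ {k r} v → k * L + r < length (ĥ v) → k < length v
  block-index {k} {r} v lt = *-cancelʳ-< L k (length v) (≤-<-trans (m≤m+n (k * L) r) (subst (k * L + r <_) (length-ĥ v) lt))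

  module SquareFreeImage
    (h-injective : Injective _≡_ _≡_ h)
    (t m : ℕ) (m>0 : m > 0) (t+m≤L : t + m ≤ L) (marker-early : (t + m) + (t + m) ≤ L + 3)
    (synchronizing : ∀ y z y′ r → r < L → slice r m (h y ++ h z) ≡ slice t m (h y′) → r ≡ t)
    (rigid : ∀ y z x r → r < L → drop r (h y) ≡ drop r (h z) → take r (h z) ≡ take r (h x) → y ≡ z ⊎ z ≡ x)
    where

    marker-synchronizes : ∀ v b r′ y′ → r′ < L → b * L + r′ + m ≤ length (ĥ v) →
                          slice (b * L + r′) m (ĥ v) ≡ slice t m (h y′) → r′ ≡ t
    marker-synchronizes v b r′ y′ r′<L bound eq = synchronized (drop-∷ b v b<n)
      where
      open ≡-Reasoning
      b<n : b < length v
      b<n = block-index v (<-≤-trans (m<m+n (b * L + r′) m>0) bound)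
      synchronized : (∃₂ λ y rest → drop b v ≡ y ∷ rest) → r′ ≡ t
      synchronized (y , [] , block) = synchronizing y y y′ r′ r′<L (begin
        slice r′ m (h y ++ h y)    ≡⟨ slice-++-≤ r′ m (h y) (h y) r′+m≤L ⟩
        slice r′ m (h y)           ≡⟨ slice-++-≤ r′ m (h y) [] r′+m≤L ⟨
        slice r′ m (h y ++ [])     ≡⟨ slice-ĥ-from b v block r′ m ⟨
        slice (b * L + r′) m (ĥ v) ≡⟨ eq ⟩
        slice t m (h y′)           ∎)
        where
        last : length v ≡ b + 1
        last = trans (sym (m+[n∸m]≡n (<⇒≤ b<n))) (cong (b +_) (trans (sym (length-drop b v)) (cong length block)))
        r′+m≤L : r′ + m ≤ length (h y)
        r′+m≤L = subst (r′ + m ≤_) (sym (uniform y)) (+-cancelˡ-≤ (b * L) _ _ (subst₂ _≤_ (+-assoc (b * L) r′ m)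
                   (trans (trans (length-ĥ v) (cong (_* L) last)) (+1*L b L)) bound))
          where +1*L : ∀ b L → (b + 1) * L ≡ b * L + L
                +1*L = solve-∀
      synchronized (y , z ∷ rest , block) = synchronizing y z y′ r′ r′<L (begin
        slice r′ m (h y ++ h z)               ≡⟨ slice-++-≤ r′ m (h y ++ h z) (ĥ rest) r′+m≤ ⟨
        slice r′ m ((h y ++ h z) ++ ĥ rest)   ≡⟨ cong (slice r′ m) (++-assoc (h y) (h z) (ĥ rest)) ⟩
        slice r′ m (h y ++ ĥ (z ∷ rest))      ≡⟨ slice-ĥ-from b v block r′ m ⟨
        slice (b * L + r′) m (ĥ v)            ≡⟨ eq ⟩
        slice t m (h y′)                      ∎)
        where
        r′+m≤ : r′ + m ≤ length (h y ++ h z)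
        r′+m≤ = subst (r′ + m ≤_) (sym (trans (length-++ (h y)) (cong₂ _+_ (uniform y) (uniform z))))
                  (+-mono-≤ (<⇒≤ r′<L) (≤-trans (m≤n+m m t) t+m≤L))

    squareAt-in-blocks : ∀ v b k {i p} → SquareAt (ĥ v) i p → b * L ≤ i → i + (p + p) ≤ b * L + k * L →
                         b + k ≤ length v → ¬ SquareFree (ĥ (slice b k v))
    squareAt-in-blocks v b k {i} {p} sq start end b+k≤n sf =
      squareFree⇒¬squareAt sf (i ∸ b * L) p (subst (λ W → SquareAt W (i ∸ b * L) p) (slice-ĥ b k v)
        (squareAt-slice (b * L) (k * L) sq start end
          (subst₂ _≤_ (*-distribʳ-+ L b k) (sym (length-ĥ v)) (*-monoˡ-≤ L b+k≤n))))

    -- marker-early is exactly what makes a short square fit into the images of four letters.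
    short-square-in-window : ∀ v → 4 ≤ length v → ∀ {a r p} → r < L → p < L + (t + m) →
                             SquareAt (ĥ v) (a * L + r) p → ∃ λ b → b + 4 ≤ length v × ¬ SquareFree (ĥ (slice b 4 v))
    short-square-in-window v 4≤n {a} {r} {p} r<L p< sq@(_ , bound , _) with a + 4 ≤? length v
    ... | yes a+4≤n = a , a+4≤n , squareAt-in-blocks v a 4 sq (m≤m+n (a * L) r) (begin
      a * L + r + (p + p)    ≡⟨ +-assoc (a * L) r (p + p) ⟩
      a * L + (r + (p + p))  ≤⟨ +-monoʳ-≤ (a * L) fits ⟩
      a * L + 4 * L          ∎) a+4≤n
      where
      open ≤-Reasoning
      fits : r + (p + p) ≤ 4 * L
      fits = +-cancelˡ-≤ 3 _ _ (begin
        3 + (r + (p + p))                        ≡⟨ suc-shift r p ⟩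
        suc r + (suc p + suc p)                  ≤⟨ +-mono-≤ r<L (+-mono-≤ p< p<) ⟩
        L + ((L + (t + m)) + (L + (t + m)))      ≡⟨ regroup L (t + m) ⟩
        L + L + L + ((t + m) + (t + m))          ≤⟨ +-monoʳ-≤ (L + L + L) marker-early ⟩
        L + L + L + (L + 3)                      ≡⟨ four L ⟩
        3 + 4 * L                                ∎)
        where
        suc-shift : ∀ r p → 3 + (r + (p + p)) ≡ suc r + (suc p + suc p)
        suc-shift = solve-∀
        regroup : ∀ L s → L + ((L + s) + (L + s)) ≡ L + L + L + (s + s)
        regroup = solve-∀
        four : ∀ L → L + L + L + (L + 3) ≡ 3 + 4 * L
        four = solve-∀
    ... | no a+4≰n = b , ≤-reflexive b+4≡n , squareAt-in-blocks v b 4 sq (≤-trans (*-monoˡ-≤ L b≤a) (m≤m+n (a * L) r))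
                                                      (≤-trans bound (≤-reflexive ĥv≡)) (≤-reflexive b+4≡n)
      where
      n = length v
      b = n ∸ 4
      b+4≡n : b + 4 ≡ n
      b+4≡n = m∸n+n≡m 4≤n
      b≤a : b ≤ a
      b≤a = subst (b ≤_) (m+n∸n≡m a 4) (∸-monoˡ-≤ 4 (<⇒≤ (≰⇒> a+4≰n)))
      ĥv≡ : length (ĥ v) ≡ b * L + 4 * L
      ĥv≡ = trans (length-ĥ v) (trans (cong (_* L) (sym b+4≡n)) (*-distribʳ-+ L b 4))

    -- The marker of the block after the square's start synchronizes with its copy one period later.
    long-square-period : ∀ v {a r p} → r < L → L + (t + m) ≤ p → SquareAt (ĥ v) (a * L + r) p →
                         ∃ λ q → p ≡ suc q * L
    long-square-period v {a} {r} {p} r<L long sq@(p>0 , bound , _) = period (b ∸ k) p≡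
      where
      i = a * L + r
      k = suc a
      o = k * L + t
      i≤o : i ≤ o
      i≤o = ≤-trans (+-monoʳ-≤ (a * L) (<⇒≤ r<L)) (≤-trans (≤-reflexive (+-comm (a * L) L)) (m≤m+n (k * L) t))
      o+m≤i+p : o + m ≤ i + p
      o+m≤i+p = begin
        k * L + t + m        ≡⟨ shift a L t m ⟩
        a * L + (L + (t + m)) ≤⟨ +-monoʳ-≤ (a * L) long ⟩
        a * L + p            ≤⟨ +-monoˡ-≤ p (m≤m+n (a * L) r) ⟩
        i + p                ∎
        where
        open ≤-Reasoning
        shift : ∀ a L t m → suc a * L + t + m ≡ a * L + (L + (t + m))
        shift = solve-∀
      o+p+m≤ : o + p + m ≤ length (ĥ v)
      o+p+m≤ = begin
        o + p + m            ≡⟨ +-assoc o p m ⟩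
        o + (p + m)          ≡⟨ cong (o +_) (+-comm p m) ⟩
        o + (m + p)          ≡⟨ +-assoc o m p ⟨
        o + m + p            ≤⟨ +-monoˡ-≤ p o+m≤i+p ⟩
        i + p + p            ≡⟨ +-assoc i p p ⟩
        i + (p + p)          ≤⟨ bound ⟩
        length (ĥ v)         ∎
        where open ≤-Reasoning
      k<n : k < length v
      k<n = block-index v (begin-strict
        o               <⟨ m<m+n o m>0 ⟩
        o + m           ≤⟨ o+m≤i+p ⟩
        i + p           ≤⟨ +-monoʳ-≤ i (m≤m+n p p) ⟩
        i + (p + p)     ≤⟨ bound ⟩
        length (ĥ v)    ∎)
        where open ≤-Reasoning
      b = (o + p) / L
      r′ = (o + p) % L
      o+p≡ : o + p ≡ b * L + r′
      o+p≡ = trans (m≡m%n+[m/n]*n (o + p) L) (+-comm r′ (b * L))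
      r′≡t : r′ ≡ t
      r′≡t with drop-∷ k v k<n
      ... | y , _ , block =
        marker-synchronizes v b r′ y (m%n<n (o + p) L) (subst (λ j → j + m ≤ length (ĥ v)) o+p≡ o+p+m≤) copied
        where
        copied : slice (b * L + r′) m (ĥ v) ≡ slice t m (h y)
        copied = begin
          slice (b * L + r′) m (ĥ v)  ≡⟨ cong (λ j → slice j m (ĥ v)) o+p≡ ⟨
          slice (o + p) m (ĥ v)       ≡⟨ squareAt-copy o m sq i≤o o+m≤i+p ⟨
          slice o m (ĥ v)             ≡⟨ slice-ĥ-block k v block t m t+m≤L ⟩
          slice t m (h y)             ∎
          where open ≡-Reasoning
      p≡ : p ≡ (b ∸ k) * L
      p≡ = begin
        p                       ≡⟨ m+n∸m≡n (k * L) p ⟨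
        k * L + p ∸ k * L       ≡⟨ cong (_∸ k * L) (+-cancelʳ-≡ t (k * L + p) (b * L) (begin
            k * L + p + t           ≡⟨ swap (k * L) p t ⟩
            o + p                   ≡⟨ o+p≡ ⟩
            b * L + r′              ≡⟨ cong (b * L +_) r′≡t ⟩
            b * L + t               ∎)) ⟩
        b * L ∸ k * L           ≡⟨ *-distribʳ-∸ L b k ⟨
        (b ∸ k) * L             ∎
        where
        open ≡-Reasoning
        swap : ∀ x p t → x + p + t ≡ x + t + p
        swap = solve-∀
      period : ∀ q′ → p ≡ q′ * L → ∃ λ q → p ≡ suc q * L
      period zero    p≡0 = ⊥-elim (<⇒≢ p>0 (sym p≡0))
      period (suc q) p≡  = q , p≡

    aligned-middle : ∀ v a r q → r < L → SquareAt (ĥ v) (a * L + r) (suc q * L) →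
                     slice (suc a) q v ≡ slice (suc (a + suc q)) q v
    aligned-middle v a r q r<L sq = ĥ-injective h-injective (begin
      ĥ (slice (suc a) q v)                       ≡⟨ slice-ĥ (suc a) q v ⟨
      slice (suc a * L) (q * L) (ĥ v)             ≡⟨ squareAt-copy (suc a * L) (q * L) sq start end ⟩
      slice (suc a * L + suc q * L) (q * L) (ĥ v) ≡⟨ cong (λ j → slice j (q * L) (ĥ v)) (jump a q L) ⟩
      slice (suc (a + suc q) * L) (q * L) (ĥ v)   ≡⟨ slice-ĥ (suc (a + suc q)) q v ⟩
      ĥ (slice (suc (a + suc q)) q v)             ∎)
      where
      open ≡-Reasoning
      jump : ∀ a q L → suc a * L + suc q * L ≡ suc (a + suc q) * L
      jump = solve-∀
      blocks : ∀ a q L → suc a * L + q * L ≡ a * L + suc q * L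
      blocks = solve-∀
      start : a * L + r ≤ suc a * L
      start = ≤-trans (+-monoʳ-≤ (a * L) (<⇒≤ r<L)) (≤-reflexive (+-comm (a * L) L))
      end : suc a * L + q * L ≤ a * L + r + suc q * L
      end = ≤-trans (≤-reflexive (blocks a q L)) (+-monoˡ-≤ (suc q * L) (m≤m+n (a * L) r))

    aligned-edges : ∀ v a r q {y z x ry rz rx} → r < L → SquareAt (ĥ v) (a * L + r) (suc q * L) →
                    drop a v ≡ y ∷ ry → drop (a + suc q) v ≡ z ∷ rz → drop (a + suc q + suc q) v ≡ x ∷ rx →
                    drop r (h y) ≡ drop r (h z) × take r (h z) ≡ take r (h x)
    aligned-edges v a r q {y} {z} {x} r<L sq at-y at-z at-x = suffixes , prefixes
      where
      open ≡-Reasoning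
      Q = suc q
      i = a * L + r
      shifted : i + Q * L ≡ (a + Q) * L + r
      shifted = shift a Q L r
        where shift : ∀ a Q L r → a * L + r + Q * L ≡ (a + Q) * L + r
              shift = solve-∀
      suffixes = begin
        drop r (h y)                          ≡⟨ slice-ĥ-suffix a v at-y r (<⇒≤ r<L) ⟨
        slice i (L ∸ r) (ĥ v)                 ≡⟨ squareAt-copy i (L ∸ r) sq ≤-refl
                                                   (+-monoʳ-≤ i (≤-trans (m∸n≤m L r) (m≤m+n L (q * L)))) ⟩
        slice (i + Q * L) (L ∸ r) (ĥ v)       ≡⟨ cong (λ j → slice j (L ∸ r) (ĥ v)) shifted ⟩
        slice ((a + Q) * L + r) (L ∸ r) (ĥ v) ≡⟨ slice-ĥ-suffix (a + Q) v at-z r (<⇒≤ r<L) ⟩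
        drop r (h z)                          ∎
      prefixes = begin
        take r (h z)                          ≡⟨ slice-ĥ-prefix (a + Q) v at-z r (<⇒≤ r<L) ⟨
        slice ((a + Q) * L) r (ĥ v)           ≡⟨ squareAt-copy ((a + Q) * L) r sq start (≤-reflexive (sym shifted)) ⟩
        slice ((a + Q) * L + Q * L) r (ĥ v)   ≡⟨ cong (λ j → slice j r (ĥ v)) (*-distribʳ-+ L (a + Q) Q) ⟨
        slice ((a + Q + Q) * L) r (ĥ v)       ≡⟨ slice-ĥ-prefix (a + Q + Q) v at-x r (<⇒≤ r<L) ⟩
        take r (h x)                          ∎
        where
        start : i ≤ (a + Q) * L
        start = ≤-trans (+-monoʳ-≤ (a * L) (≤-trans (<⇒≤ r<L) (m≤m+n L (q * L)))) (≤-reflexive (sym (*-distribʳ-+ L a Q)))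

    -- With the rigidity of h, a square of period a multiple of L pulls back to a square of v.
    aligned-square : ∀ v → SquareFree v → ∀ a r q → r < L → ¬ SquareAt (ĥ v) (a * L + r) (suc q * L)
    aligned-square v sf a zero q _ (_ , bound , halves) =
      squareFree⇒¬squareAt sf a Q
        (s≤s z≤n , *-cancelʳ-≤ (a + (Q + Q)) (length v) L (subst₂ _≤_ (end a Q L) (length-ĥ v) bound) ,
        ĥ-injective h-injective (begin
          ĥ (slice a Q v)                          ≡⟨ slice-ĥ a Q v ⟨
          slice (a * L) (Q * L) (ĥ v)              ≡⟨ cong (λ j → slice j (Q * L) (ĥ v)) (+-identityʳ (a * L)) ⟨
          slice (a * L + 0) (Q * L) (ĥ v)          ≡⟨ halves ⟩
          slice (a * L + 0 + Q * L) (Q * L) (ĥ v)  ≡⟨ cong (λ j → slice j (Q * L) (ĥ v)) (next a Q L) ⟩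
          slice ((a + Q) * L) (Q * L) (ĥ v)        ≡⟨ slice-ĥ (a + Q) Q v ⟩
          ĥ (slice (a + Q) Q v)                    ∎))
      where
      open ≡-Reasoning
      Q = suc q
      next : ∀ a Q L → a * L + 0 + Q * L ≡ (a + Q) * L
      next = solve-∀
      end : ∀ a Q L → a * L + 0 + (Q * L + Q * L) ≡ (a + (Q + Q)) * L
      end = solve-∀
    aligned-square v sf a r@(suc _) q r<L sq@(_ , bound , _) =
      three-blocks (drop-∷ a v (≤-<-trans (m≤m+n a (Q + Q)) a+2Q<n))
                   (drop-∷ (a + Q) v (≤-<-trans (+-monoʳ-≤ a (m≤m+n Q Q)) a+2Q<n))
                   (drop-∷ (a + Q + Q) v (subst (_< length v) (sym (+-assoc a Q Q)) a+2Q<n))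
      where
      Q = suc q
      a+2Q<n : a + (Q + Q) < length v
      a+2Q<n = *-cancelʳ-< L _ (length v) (begin-strict
        (a + (Q + Q)) * L           <⟨ m<m+n _ (s≤s z≤n) ⟩
        (a + (Q + Q)) * L + r       ≡⟨ end a Q L r ⟩
        a * L + r + (Q * L + Q * L) ≤⟨ bound ⟩
        length (ĥ v)                ≡⟨ length-ĥ v ⟩
        length v * L                ∎)
        where
        open ≤-Reasoning
        end : ∀ a Q L r → (a + (Q + Q)) * L + r ≡ a * L + r + (Q * L + Q * L)
        end = solve-∀
      three-blocks : (∃₂ λ y rest → drop a v ≡ y ∷ rest) → (∃₂ λ z rest → drop (a + Q) v ≡ z ∷ rest) →
                     (∃₂ λ x rest → drop (a + Q + Q) v ≡ x ∷ rest) → ⊥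
      three-blocks (y , _ , at-y) (z , _ , at-z) (x , _ , at-x) =
        [ square-at-a , square-after-a ]′ (rigid y z x r r<L (proj₁ edges) (proj₂ edges))
        where
        open ≡-Reasoning
        edges = aligned-edges v a r q r<L sq at-y at-z at-x
        square-at-a : y ≡ z → ⊥
        square-at-a y≡z = squareFree⇒¬squareAt sf a Q (s≤s z≤n , <⇒≤ a+2Q<n , (begin
          slice a Q v                  ≡⟨ slice-∷ a q v at-y ⟩
          y ∷ slice (suc a) q v        ≡⟨ cong₂ _∷_ y≡z (aligned-middle v a r q r<L sq) ⟩
          z ∷ slice (suc (a + Q)) q v  ≡⟨ slice-∷ (a + Q) q v at-z ⟨
          slice (a + Q) Q v            ∎))
        square-after-a : z ≡ x → ⊥
        square-after-a z≡x = squareFree⇒¬squareAt sf (suc a) Q (s≤s z≤n , a+2Q<n , (begin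
          slice (suc a) Q v             ≡⟨ slice-∷ʳ (suc a) q v (trans (cong (λ j → drop j v) (sym (+-suc a q))) at-z) ⟩
          slice (suc a) q v ∷ʳ z        ≡⟨ cong₂ _∷ʳ_ (aligned-middle v a r q r<L sq) z≡x ⟩
          slice (suc (a + Q)) q v ∷ʳ x  ≡⟨ slice-∷ʳ (suc (a + Q)) q v (trans (cong (λ j → drop j v) (sym (+-suc (a + Q) q))) at-x) ⟨
          slice (suc a + Q) Q v         ∎))

    squareFree-ĥ : ∀ v → SquareFree v → 4 ≤ length v → (∀ b → b + 4 ≤ length v → SquareFree (ĥ (slice b 4 v))) →
                   SquareFree (ĥ v)
    squareFree-ĥ v sf 4≤n windows = ¬squareAt⇒squareFree λ i p sq →
      noSquare (i / L) (i % L) p (m%n<n i L)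
        (subst (λ j → SquareAt (ĥ v) j p) (trans (m≡m%n+[m/n]*n i L) (+-comm (i % L) _)) sq)
      where
      noSquare : ∀ a r p → r < L → ¬ SquareAt (ĥ v) (a * L + r) p
      noSquare a r p r<L sq with p <? L + (t + m)
      ... | yes p-short = let b , b+4≤n , ¬sf = short-square-in-window v 4≤n {a} r<L p-short sq in ¬sf (windows b b+4≤n)
      ... | no p-long with long-square-period v {a} r<L (≮⇒≥ p-long) sq
      ...   | q , refl = aligned-square v sf a r q r<L sq

-- The morphism h

pattern a0 = zero
pattern a1 = suc zero
pattern a2 = suc (suc zero)

-- The ternary alphabet extended by two letters ⊢ and ⊣, whose images frame the extremal words.
data Λ : Set where
  ι   : Fin 3 → Λ
  ⊢ ⊣ : Λ

ι-injective : ∀ {x y} → ι x ≡ ι y → x ≡ y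
ι-injective refl = refl

_≟Λ_ : DecidableEquality Λ
ι x ≟Λ ι y = map′ (cong ι) ι-injective (x ≟ᶠ y)
ι _ ≟Λ ⊢   = no λ ()
ι _ ≟Λ ⊣   = no λ ()
⊢   ≟Λ ι _ = no λ ()
⊢   ≟Λ ⊢   = yes refl
⊢   ≟Λ ⊣   = no λ ()
⊣   ≟Λ ι _ = no λ ()
⊣   ≟Λ ⊢   = no λ ()
⊣   ≟Λ ⊣   = yes refl

all-Λ? : {P : Λ → Set} → Decidable P → Dec (∀ y → P y)
all-Λ? {P} P? = map′ every (λ ∀P → ∀P ∘ ι , ∀P ⊢ , ∀P ⊣) (all? (P? ∘ ι) ×-dec P? ⊢ ×-dec P? ⊣)
  where
  every : (∀ x → P (ι x)) × P ⊢ × P ⊣ → ∀ y → P y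
  every (Pι , P⊢ , P⊣) (ι x) = Pι x
  every (Pι , P⊢ , P⊣) ⊢     = P⊢
  every (Pι , P⊢ , P⊣) ⊣     = P⊣

all-words? : ∀ k {P : List (Fin 3) → Set} → Decidable P → Dec (∀ u → length u ≡ k → P u)
all-words? zero    P? = map′ (λ { P[] [] _ → P[] }) (λ ∀P → ∀P [] refl) (P? [])
all-words? (suc k) P? =
  map′ (λ { ∀P (x ∷ u) eq → ∀P x u (suc-injective eq) }) (λ ∀P x u eq → ∀P (x ∷ u) (cong suc eq))
       (all? λ x → all-words? k (P? ∘ (x ∷_)))

rotate : Fin 3 → Fin 3
rotate a0 = a1
rotate a1 = a2
rotate a2 = a0

B⊢ B⊣ B : List (Fin 3)
B  = a0 ∷ a1 ∷ a2 ∷ a0 ∷ a2 ∷ a1 ∷ a0 ∷ a2 ∷ a0 ∷ a1 ∷ a2 ∷ a1 ∷ a0 ∷ a2 ∷ a1 ∷ a2 ∷ a0 ∷ a1 ∷ a0 ∷ a2 ∷ a1 ∷ a0 ∷ a1 ∷ a2 ∷ a1 ∷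
     a0 ∷ a2 ∷ a0 ∷ a1 ∷ a0 ∷ a2 ∷ a1 ∷ a0 ∷ a1 ∷ a2 ∷ a0 ∷ a2 ∷ a1 ∷ a2 ∷ a0 ∷ a1 ∷ a0 ∷ a2 ∷ a0 ∷ a1 ∷ a2 ∷ a0 ∷ a2 ∷ a1 ∷ a0 ∷ []
B⊢ = a2 ∷ a1 ∷ a2 ∷ a0 ∷ a1 ∷ a0 ∷ a2 ∷ a1 ∷ a0 ∷ a1 ∷ a2 ∷ a0 ∷ a2 ∷ a1 ∷ a2 ∷ a0 ∷ a1 ∷ a0 ∷ a2 ∷ a1 ∷ a0 ∷ a1 ∷ a2 ∷ a1 ∷ a0 ∷
     a2 ∷ a0 ∷ a1 ∷ a0 ∷ a2 ∷ a1 ∷ a0 ∷ a1 ∷ a2 ∷ a0 ∷ a2 ∷ a1 ∷ a2 ∷ a0 ∷ a1 ∷ a0 ∷ a2 ∷ a1 ∷ a0 ∷ a1 ∷ a2 ∷ a0 ∷ a1 ∷ a0 ∷ a2 ∷ []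
B⊣ = a2 ∷ a0 ∷ a1 ∷ a0 ∷ a2 ∷ a1 ∷ a0 ∷ a1 ∷ a2 ∷ a0 ∷ a1 ∷ a0 ∷ a2 ∷ a1 ∷ a2 ∷ a0 ∷ a2 ∷ a1 ∷ a0 ∷ a1 ∷ a2 ∷ a0 ∷ a1 ∷ a0 ∷ a2 ∷
     a0 ∷ a1 ∷ a2 ∷ a1 ∷ a0 ∷ a1 ∷ a2 ∷ a0 ∷ a1 ∷ a0 ∷ a2 ∷ a1 ∷ a2 ∷ a0 ∷ a2 ∷ a1 ∷ a0 ∷ a1 ∷ a2 ∷ a0 ∷ a1 ∷ a0 ∷ a2 ∷ a1 ∷ a2 ∷ []

h : Λ → List (Fin 3)
h (ι a0) = B
h (ι a1) = map rotate B
h (ι a2) = map rotate (map rotate B)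
h ⊢      = B⊢
h ⊣      = B⊣

h-uniform : ∀ y → length (h y) ≡ 50
h-uniform (ι a0) = refl
h-uniform (ι a1) = refl
h-uniform (ι a2) = refl
h-uniform ⊢      = refl
h-uniform ⊣      = refl

open Uniform h 50 h-uniform

frame : List (Fin 3) → List Λ
frame w = ⊢ ∷ map ι w ∷ʳ ⊣

framed : List (Fin 3) → List (Fin 3)
framed w = ĥ (frame w)

W⊢ W⊣ : List (Fin 3)
W⊢ = ĥ (⊢ ∷ ι a0 ∷ ι a1 ∷ ι a2 ∷ [])
W⊣ = ĥ (ι a2 ∷ ι a1 ∷ ι a0 ∷ ⊣ ∷ [])

-- Facts established by computation.  They are opaque because, applied to open terms, they would
-- otherwise be unfolded and their proofs re-run by the type checker.
opaque
  h-injective : Injective _≡_ _≡_ h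
  h-injective {y} {z} = from-yes (all-Λ? λ y → all-Λ? λ z → ≡-dec _≟ᶠ_ (h y) (h z) →-dec (y ≟Λ z)) y z

  h-synchronizing : ∀ y z y′ r → r < 50 → slice r 16 (h y ++ h z) ≡ slice 10 16 (h y′) → r ≡ 10
  h-synchronizing y z y′ r = from-yes (all-Λ? λ y → all-Λ? λ z → all-Λ? λ y′ → allUpTo? (λ r →
    ≡-dec _≟ᶠ_ (slice r 16 (h y ++ h z)) (slice 10 16 (h y′)) →-dec r ≟ 10) 50) y z y′

  h-rigid : ∀ y z x r → r < 50 → drop r (h y) ≡ drop r (h z) → take r (h z) ≡ take r (h x) → y ≡ z ⊎ z ≡ x
  h-rigid y z x r = from-yes (all-Λ? λ y → all-Λ? λ z → all-Λ? λ x → allUpTo? (λ r →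
    ≡-dec _≟ᶠ_ (drop r (h y)) (drop r (h z)) →-dec ≡-dec _≟ᶠ_ (take r (h z)) (take r (h x)) →-dec
    (y ≟Λ z ⊎-dec z ≟Λ x)) 50) y z x

  B-squareFree : SquareFree B
  B-squareFree = from-yes (squareFree? _≟ᶠ_ B)

  W⊢-squareFree : SquareFree W⊢
  W⊢-squareFree = from-yes (squareFree? _≟ᶠ_ W⊢)

  W⊣-squareFree : SquareFree W⊣
  W⊣-squareFree = from-yes (squareFree? _≟ᶠ_ W⊣)

  image-windows : ∀ u → length u ≡ 4 → ¬ SquareFree u ⊎ SquareFree (ĥ (map ι u))
  image-windows = from-yes (all-words? 4 λ u → ¬? (squareFree? _≟ᶠ_ u) ⊎-dec squareFree? _≟ᶠ_ (ĥ (map ι u)))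

  -- The square created by an insertion lies close to it; the slices only keep the search short.
  front-insertions : ∀ {j} → j < 100 → ∀ x → ¬ SquareFree (slice (j ∸ 44) 70 (insert j x W⊢))
  front-insertions = from-yes (allUpTo? (λ j → all? λ x →
    ¬? (squareFree? _≟ᶠ_ (slice (j ∸ 44) 70 (insert j x W⊢)))) 100)

  end-insertions : ∀ {d} → d < 101 → ∀ x → ¬ SquareFree (slice (56 + d) 70 (insert (100 + d) x W⊣))
  end-insertions = from-yes (allUpTo? (λ d → all? λ x →
    ¬? (squareFree? _≟ᶠ_ (slice (56 + d) 70 (insert (100 + d) x W⊣)))) 101)

  middle-insertions : ∀ u → length u ≡ 3 → ¬ SquareFree u ⊎
                      (∀ {r} → r < 50 → ∀ x → ¬ SquareFree (slice (30 + r) 32 (insert (50 + r) x (ĥ (map ι u)))))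
  middle-insertions = from-yes (all-words? 3 λ u → ¬? (squareFree? _≟ᶠ_ u) ⊎-dec allUpTo? (λ r → all? λ x →
    ¬? (squareFree? _≟ᶠ_ (slice (30 + r) 32 (insert (50 + r) x (ĥ (map ι u)))))) 50)

open SquareFreeImage h-injective 10 16 (s≤s z≤n) (m≤m+n 26 24) (m≤m+n 52 1) h-synchronizing h-rigid

-- Framed words

length-frame : ∀ w → length (frame w) ≡ length w + 2
length-frame w = trans (cong suc (trans (length-++ (map ι w)) (cong (_+ 1) (length-map ι w)))) (sym (+-suc (length w) 1))

squareFree-frame : ∀ {w} → SquareFree w → SquareFree (frame w)
squareFree-frame {w} sf = squareFree-∷ ⊢∉ (squareFree-∷ʳ ⊣∉ (squareFree-map ι-injective sf))
  where
  ⊣∉ : ⊣ ∉ map ι w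
  ⊣∉ ⊣∈ with ∈-map⁻ ι ⊣∈
  ... | _ , _ , ()
  ⊢∉ : ⊢ ∉ map ι w ∷ʳ ⊣
  ⊢∉ ⊢∈ with ∈-++⁻ (map ι w) ⊢∈
  ... | inj₁ ⊢∈w with ∈-map⁻ ι ⊢∈w
  ...   | _ , _ , ()
  ⊢∉ ⊢∈ | inj₂ (here ())

slice-frame : ∀ b K w → b + K ≤ length w → slice (suc b) K (frame w) ≡ map ι (slice b K w)
slice-frame b K w b+K≤w =
  trans (slice-++-≤ b K (map ι w) (⊣ ∷ []) (subst (b + K ≤_) (sym (length-map ι w)) b+K≤w)) (slice-map ι b K w)

record Admissible (w : List (Fin 3)) : Set where
  field
    squareFree : SquareFree w
    starts     : ∃ λ r → w ≡ a0 ∷ a1 ∷ a2 ∷ r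
    ends       : ∃ λ r → w ≡ r ++ a2 ∷ a1 ∷ a0 ∷ []

open Admissible

frame-windows : ∀ {w} → Admissible w → ∀ b → b + 4 ≤ length (frame w) → SquareFree (ĥ (slice b 4 (frame w)))
frame-windows adm zero _ with starts adm
... | _ , refl = W⊢-squareFree
frame-windows {w} adm (suc b) b+4≤ with b + 4 ≤? length w
... | yes b+4≤w with image-windows (slice b 4 w) (length-slice b 4 w b+4≤w)
...   | inj₁ ¬sf = ⊥-elim (¬sf (squareFree-factor (slice-factor b 4 w) (squareFree adm)))
...   | inj₂ sf  = subst (SquareFree ∘ ĥ) (sym (slice-frame b 4 w b+4≤w)) sf
frame-windows {w} adm (suc b) b+4≤ | no b+4≰w with ends adm
... | r , refl = subst (SquareFree ∘ ĥ) (sym last-window) W⊣-squareFree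
  where
  |w| : length w ≡ length r + 3
  |w| = length-++ r
  b≡r : b ≡ length r
  b≡r = ≤-antisym
    (+-cancelʳ-≤ 5 b (length r) (begin
      b + 5               ≡⟨ +-suc b 4 ⟩
      suc b + 4           ≤⟨ b+4≤ ⟩
      length (frame w)    ≡⟨ length-frame w ⟩
      length w + 2        ≡⟨ cong (_+ 2) |w| ⟩
      length r + 3 + 2    ≡⟨ +-assoc (length r) 3 2 ⟩
      length r + 5        ∎))
    (+-cancelʳ-≤ 4 (length r) b (begin
      length r + 4        ≡⟨ +-suc (length r) 3 ⟩
      suc (length r + 3)  ≡⟨ cong suc |w| ⟨
      suc (length w)      ≤⟨ ≰⇒> b+4≰w ⟩
      b + 4               ∎))
    where open ≤-Reasoning
  last-window : slice (suc b) 4 (frame w) ≡ ι a2 ∷ ι a1 ∷ ι a0 ∷ ⊣ ∷ []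
  last-window = begin
    take 4 (drop b (map ι (r ++ a2 ∷ a1 ∷ a0 ∷ []) ++ ⊣ ∷ []))
      ≡⟨ cong (λ z → take 4 (drop b (z ++ ⊣ ∷ []))) (map-++ ι r (a2 ∷ a1 ∷ a0 ∷ [])) ⟩
    take 4 (drop b ((map ι r ++ ι a2 ∷ ι a1 ∷ ι a0 ∷ []) ++ ⊣ ∷ []))
      ≡⟨ cong (take 4 ∘ drop b) (++-assoc (map ι r) _ _) ⟩
    take 4 (drop b (map ι r ++ ι a2 ∷ ι a1 ∷ ι a0 ∷ ⊣ ∷ []))
      ≡⟨ cong (take 4) (drop-++-length (map ι r) _ (trans (length-map ι r) (sym b≡r))) ⟩
    ι a2 ∷ ι a1 ∷ ι a0 ∷ ⊣ ∷ [] ∎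
    where open ≡-Reasoning

framed-squareFree : ∀ {w} → Admissible w → SquareFree (framed w)
framed-squareFree {w} adm = squareFree-ĥ (frame w) (squareFree-frame (squareFree adm)) 4≤ (frame-windows adm)
  where
  4≤ : 4 ≤ length (frame w)
  4≤ with starts adm
  ... | r , refl = subst (4 ≤_) (sym (length-frame w)) (≤-trans (n≤1+n 4) (+-monoˡ-≤ 2 (s≤s (s≤s (s≤s z≤n)))))

front-extension : ∀ r j x → j < 100 → ¬ SquareFree (insert j x (framed (a0 ∷ a1 ∷ a2 ∷ r)))
front-extension r j x j<100 =
  subst (λ V → ¬ SquareFree (insert j x V)) (sym (concatMap-++ h (⊢ ∷ ι a0 ∷ ι a1 ∷ ι a2 ∷ []) (map ι r ∷ʳ ⊣)))
    (¬squareFree-inside [] W⊢ (ĥ (map ι r ∷ʳ ⊣)) j x (≤-trans (<⇒≤ j<100) (m≤m+n 100 100))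
      (¬squareFree-slice (j ∸ 44) 70 _ (front-insertions j<100 x)))

end-extension : ∀ r j x → length (framed (r ++ a2 ∷ a1 ∷ a0 ∷ [])) ≤ j + 100 →
                j ≤ length (framed (r ++ a2 ∷ a1 ∷ a0 ∷ [])) → ¬ SquareFree (insert j x (framed (r ++ a2 ∷ a1 ∷ a0 ∷ [])))
end-extension r j x outer j≤ =
  subst (λ i → ¬ SquareFree (insert i x (framed (r ++ a2 ∷ a1 ∷ a0 ∷ [])))) (sym j≡)
    (subst (λ V → ¬ SquareFree (insert (length P + (100 + d)) x V)) (sym split)
      (¬squareFree-inside P W⊣ [] (100 + d) x (+-monoʳ-≤ 100 d≤100)
        (¬squareFree-slice (56 + d) 70 _ (end-insertions (s≤s d≤100) x))))
  where
  P = ĥ (⊢ ∷ map ι r)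
  split : framed (r ++ a2 ∷ a1 ∷ a0 ∷ []) ≡ P ++ W⊣ ++ []
  split = begin
    ĥ (⊢ ∷ map ι (r ++ a2 ∷ a1 ∷ a0 ∷ []) ∷ʳ ⊣)              ≡⟨ cong (λ z → ĥ (⊢ ∷ z ∷ʳ ⊣)) (map-++ ι r (a2 ∷ a1 ∷ a0 ∷ [])) ⟩
    ĥ (⊢ ∷ (map ι r ++ ι a2 ∷ ι a1 ∷ ι a0 ∷ []) ∷ʳ ⊣)       ≡⟨ cong (λ z → ĥ (⊢ ∷ z)) (++-assoc (map ι r) _ (⊣ ∷ [])) ⟩
    ĥ ((⊢ ∷ map ι r) ++ ι a2 ∷ ι a1 ∷ ι a0 ∷ ⊣ ∷ [])         ≡⟨ concatMap-++ h (⊢ ∷ map ι r) _ ⟩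
    P ++ W⊣                                                  ≡⟨ cong (P ++_) (++-identityʳ W⊣) ⟨
    P ++ W⊣ ++ []                                            ∎
    where open ≡-Reasoning
  |framed| : length (framed (r ++ a2 ∷ a1 ∷ a0 ∷ [])) ≡ length P + 100 + 100
  |framed| = trans (cong length split) (trans (length-++ P) (sym (+-assoc (length P) 100 100)))
  P+100≤j : length P + 100 ≤ j
  P+100≤j = +-cancelʳ-≤ 100 _ _ (subst (_≤ j + 100) |framed| outer)
  d = j ∸ (length P + 100)
  j≡ : j ≡ length P + (100 + d)
  j≡ = trans (sym (m+[n∸m]≡n P+100≤j)) (+-assoc (length P) 100 d)
  d≤100 : d ≤ 100
  d≤100 = +-cancelˡ-≤ (length P + 100) _ _ (subst₂ _≤_ (trans j≡ (sym (+-assoc (length P) 100 d))) |framed| j≤)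

framed-split : ∀ w k K → k + K ≤ length w →
               framed w ≡ ĥ (take (suc k) (frame w)) ++ ĥ (map ι (slice k K w)) ++ ĥ (drop (suc k + K) (frame w))
framed-split w k K k+K≤w = begin
  ĥ v                                                          ≡⟨ cong ĥ (slice-decomposition (suc k) K v) ⟩
  ĥ (take (suc k) v ++ slice (suc k) K v ++ drop (suc k + K) v)  ≡⟨ concatMap-++ h (take (suc k) v) _ ⟩
  ĥ (take (suc k) v) ++ ĥ (slice (suc k) K v ++ drop (suc k + K) v)
    ≡⟨ cong (ĥ (take (suc k) v) ++_) (concatMap-++ h (slice (suc k) K v) _) ⟩
  ĥ (take (suc k) v) ++ ĥ (slice (suc k) K v) ++ ĥ (drop (suc k + K) v)
    ≡⟨ cong (λ z → ĥ (take (suc k) v) ++ ĥ z ++ ĥ (drop (suc k + K) v)) (slice-frame k K w k+K≤w) ⟩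
  ĥ (take (suc k) v) ++ ĥ (map ι (slice k K w)) ++ ĥ (drop (suc k + K) v) ∎
  where
  open ≡-Reasoning
  v = frame w

length-framed : ∀ w → length (framed w) ≡ length w * 50 + 100
length-framed w = trans (length-ĥ (frame w)) (trans (cong (_* 50) (length-frame w)) (distrib (length w)))
  where distrib : ∀ n → (n + 2) * 50 ≡ n * 50 + 100
        distrib = solve-∀

middle-position : ∀ w j → 100 ≤ j → j + 100 < length (framed w) →
                  ∃₂ λ k r → r < 50 × k + 3 ≤ length w × suc k * 50 + (50 + r) ≡ j
middle-position w j 100≤j inner = k , r , m%n<n e 50 , k+3≤w , trans (regroup k r) (sym j≡)
  where
  e = j ∸ 100
  k = e / 50
  r = e % 50
  regroup : ∀ k r → suc k * 50 + (50 + r) ≡ 100 + (k * 50 + r)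
  regroup = solve-∀
  shift : ∀ k → (k + 2) * 50 + 100 ≡ 100 + k * 50 + 100
  shift = solve-∀
  j≡ : j ≡ 100 + (k * 50 + r)
  j≡ = trans (sym (m+[n∸m]≡n 100≤j)) (cong (100 +_) (trans (m≡m%n+[m/n]*n e 50) (+-comm r (k * 50))))
  k+3≤w : k + 3 ≤ length w
  k+3≤w = subst (_≤ length w) (sym (+-suc k 2)) (*-cancelʳ-< 50 (k + 2) (length w) (+-cancelʳ-< 100 _ _ (begin-strict
    (k + 2) * 50 + 100        ≡⟨ shift k ⟩
    100 + k * 50 + 100        ≤⟨ +-monoˡ-≤ 100 (+-monoʳ-≤ 100 (m≤m+n (k * 50) r)) ⟩
    100 + (k * 50 + r) + 100  ≡⟨ cong (_+ 100) j≡ ⟨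
    j + 100                   <⟨ inner ⟩
    length (framed w)         ≡⟨ length-framed w ⟩
    length w * 50 + 100       ∎)))
    where open ≤-Reasoning

middle-extension : ∀ {w} → Admissible w → ∀ j x → 100 ≤ j → j + 100 < length (framed w) →
                   ¬ SquareFree (insert j x (framed w))
middle-extension {w} adm j x 100≤j inner = inside (middle-position w j 100≤j inner)
  where
  inside : (∃₂ λ k r → r < 50 × k + 3 ≤ length w × suc k * 50 + (50 + r) ≡ j) → ¬ SquareFree (insert j x (framed w))
  inside (k , r , r<50 , k+3≤w , position) =
    subst (λ i → ¬ SquareFree (insert i x (framed w))) (trans (cong (_+ (50 + r)) |P|) position)
      (subst (λ V → ¬ SquareFree (insert (length P + (50 + r)) x V)) (sym (framed-split w k 3 k+3≤w))
        (¬squareFree-inside P W C (50 + r) x (subst (50 + r ≤_) (sym |W|) (+-monoʳ-≤ 50 (≤-trans (<⇒≤ r<50) (m≤m+n 50 50))))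
          (window (middle-insertions u (length-slice k 3 w k+3≤w)))))
    where
    u = slice k 3 w
    P = ĥ (take (suc k) (frame w))
    W = ĥ (map ι u)
    C = ĥ (drop (suc k + 3) (frame w))
    |P| : length P ≡ suc k * 50
    |P| = trans (length-ĥ (take (suc k) (frame w))) (cong (_* 50) (length-take-≤ (suc k) (frame w)
            (subst (suc k ≤_) (sym (length-frame w))
              (≤-trans (≤-trans (s≤s (m≤m+n k 2)) (≤-trans (≤-reflexive (sym (+-suc k 2))) k+3≤w)) (m≤m+n (length w) 2)))))
    |W| : length W ≡ 150
    |W| = trans (length-ĥ (map ι u)) (cong (_* 50) (trans (length-map ι u) (length-slice k 3 w k+3≤w)))
    window : ¬ SquareFree u ⊎ (∀ {r} → r < 50 → ∀ x → ¬ SquareFree (slice (30 + r) 32 (insert (50 + r) x W))) →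
             ¬ SquareFree (insert (50 + r) x W)
    window (inj₁ ¬sf)      = ⊥-elim (¬sf (squareFree-factor (slice-factor k 3 w) (squareFree adm)))
    window (inj₂ inserted) = ¬squareFree-slice (30 + r) 32 _ (inserted r<50 x)

insertion-creates-square : ∀ {w} → Admissible w → ∀ j x → j ≤ length (framed w) → ¬ SquareFree (insert j x (framed w))
insertion-creates-square {w} adm j x j≤ with j <? 100 | j + 100 <? length (framed w)
... | yes j<100 | _ with starts adm
...   | r , refl = front-extension r j x j<100
insertion-creates-square adm j x j≤ | no j≮100 | yes inner = middle-extension adm j x (≮⇒≥ j≮100) inner
insertion-creates-square adm j x j≤ | no _     | no outer with ends adm
...   | r , refl = end-extension r j x (≮⇒≥ outer) j≤

framed-extremal : ∀ {w} → Admissible w → Extremal (framed w)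
framed-extremal adm = framed-squareFree adm , λ E ext → let j , x , j≤ , E≡ = extension⇒insert ext in
  subst (¬_ ∘ SquareFree) (sym E≡) (insertion-creates-square adm j x j≤)

admissible-ĥ : ∀ {w} → Admissible w → Admissible (ĥ (map ι w))
admissible-ĥ {w} adm = record
  { squareFree = squareFree-factor inside (framed-squareFree adm)
  ; starts     = image-starts w (starts adm)
  ; ends       = image-ends w (ends adm)
  }
  where
  inside : Factor (ĥ (map ι w)) (framed w)
  inside = B⊢ , B⊣ ++ [] , cong (B⊢ ++_) (concatMap-++ h (map ι w) (⊣ ∷ []))
  image-starts : ∀ w → (∃ λ r → w ≡ a0 ∷ a1 ∷ a2 ∷ r) → ∃ λ r → ĥ (map ι w) ≡ a0 ∷ a1 ∷ a2 ∷ r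
  image-starts _ (r , refl) = _ , refl
  image-ends : ∀ w → (∃ λ r → w ≡ r ++ a2 ∷ a1 ∷ a0 ∷ []) → ∃ λ r → ĥ (map ι w) ≡ r ++ a2 ∷ a1 ∷ a0 ∷ []
  image-ends _ (r , refl) = ĥ (map ι r) ++ take 147 W₂₁₀ , (begin
    ĥ (map ι (r ++ a2 ∷ a1 ∷ a0 ∷ []))                   ≡⟨ cong ĥ (map-++ ι r (a2 ∷ a1 ∷ a0 ∷ [])) ⟩
    ĥ (map ι r ++ ι a2 ∷ ι a1 ∷ ι a0 ∷ [])               ≡⟨ concatMap-++ h (map ι r) _ ⟩
    ĥ (map ι r) ++ W₂₁₀                                  ≡⟨ ++-assoc (ĥ (map ι r)) (take 147 W₂₁₀) _ ⟨
    (ĥ (map ι r) ++ take 147 W₂₁₀) ++ a2 ∷ a1 ∷ a0 ∷ []  ∎)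
    where
    open ≡-Reasoning
    W₂₁₀ = ĥ (ι a2 ∷ ι a1 ∷ ι a0 ∷ [])

iterated : ℕ → List (Fin 3)
iterated zero    = B
iterated (suc k) = ĥ (map ι (iterated k))

admissible-iterated : ∀ k → Admissible (iterated k)
admissible-iterated zero    = record { squareFree = B-squareFree ; starts = drop 3 B , refl ; ends = take 47 B , refl }
admissible-iterated (suc k) = admissible-ĥ (admissible-iterated k)

length-iterated : ∀ k → k < length (iterated k)
length-iterated zero    = s≤s z≤n
length-iterated (suc k) = ≤-trans (s≤s (length-iterated k))
  (subst (suc (length w) ≤_) (sym (trans (length-ĥ (map ι w)) (cong (_* 50) (length-map ι w))))
    (grows (length w) (≤-trans (s≤s z≤n) (length-iterated k))))
  where
  w = iterated k
  grows : ∀ n → 0 < n → suc n ≤ n * 50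
  grows (suc n) _ = s≤s (+-mono-≤ {1} {49} (s≤s z≤n) (m≤m*n n 50))

theorem1 : (n : ℕ) → n > 0 → Σ (List (Fin 3)) λ W → Extremal W × n ≤ length W
theorem1 n _ = framed w , framed-extremal (admissible-iterated n) , (begin
  n                    ≤⟨ <⇒≤ (length-iterated n) ⟩
  length w             ≤⟨ m≤m*n (length w) 50 ⟩
  length w * 50        ≤⟨ m≤m+n _ 100 ⟩
  length w * 50 + 100  ≡⟨ length-framed w ⟨
  length (framed w)    ∎)
  where
  open ≤-Reasoning
  w = iterated n
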